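{- In every H-tree and in every pre-Q-tree the paths have the following properties: (1) different paths are edge-disjoint; (2) every non-positive edge belongs to a path; (3) every leaf is the endpoint of a path; (4) a special path can only start at an internal vertex $v$ with $f_V(v)=0$, $f_E(v^-)=1$ and $f_E(v^{\mathrm L})=f_E(v^{\mathrm R})=0$.
   Context: A rooted binary plane tree $T$ has a root $v_0$ of degree 1; every other vertex is a leaf (degree 1) or internal (degree 3, with parent edge $v^-$ and ordered left/right child edges $v^{\mathrm L},v^{\mathrm R}$). $e_0$ is the edge at $v_0$. A partition tree of degree $n$ and base-length $p$ is $(T,v_0,f_V,f_E)$ with $T$ having $n$ leaves, $f_V:V_I(T)\to\mathbb{Z}_{\ge0}$ on internal vertices, $f_E:E(T)\to\mathbb{Z}$, $f_V(v)=f_E(v^{\mathrm L})+f_E(v^{\mathrm R})-f_E(v^-)+1$ for all internal $v$, and $f_E(e_0)=p$. An edge $e$ is positive if $f_E(e)>0$. An internal vertex $v$ is a bottom vertex if $\mathbf{1}_{f_E(v^-)\le0}<\mathbf{1}_{f_E(v^{\mathrm L})\le0}+\mathbf{1}_{f_E(v^{\mathrm R})\le0}$, otherwise a top vertex. An H-tree is a partition tree with $n\ge1$ such that $f_E(e)=0$ iff $e$ is incident to a leaf, and $f_V(v)=0$ for every top vertex. A pre-Q-tree is a partition tree with $n\ge1$ such that $f_E(e)\le0$ for every edge incident to a leaf and $f_V\equiv0$. Paths: (1) for each bottom vertex $v$, the regular path starts with the rightmost non-positive child edge of $v$ and then repeatedly continues with the leftmost non-positive child edge of the lower endpoint of the current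 edge, until a leaf is reached; (2) if $p\le0$, the root path starts with $e_0$ and continues by the same rule; (3) for each bottom vertex $v$ with positive parent edge and two non-positive child edges, the special path starts with $v^{\mathrm L}$ and continues by the same rule. -}

module Defs where

open import Data.Bool using (Bool; true; false; if_then_else_)
open import Data.Nat as ℕ using (ℕ)
open import Data.Integer using (ℤ; 0ℤ; 1ℤ; _+_; _-_; _≤_; _>_; _≤ᵇ_)
open import Data.Empty using (⊥)
open import Data.Unit using (⊤)
open import Data.Product using (Σ; _×_)
open import Data.Sum using (_⊎_)
open import Relation.Nullary using (¬_)
open import Relation.Binary.PropositionalEquality using (_≡_; _≢_)
open import Relation.Binary.Construct.Closure.ReflexiveTransitive using (Star)

-- The whole tree T consists of the root v0, the root edge e0, and the
-- subtree hanging below e0.  An 'LTree' is such a hanging subtree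
-- together with the f_E-value of the edge ABOVE its top vertex:
--   leaf z       : the edge above is labelled z and ends in a leaf
--   node z l r   : the edge above is labelled z and ends in an internal
--                  vertex v with left child subtree l, right child subtree r
-- So a tree with root edge e0 is an LTree t with f_E(e0) = label t = p.
data LTree : Set where
  leaf : ℤ → LTree
  node : ℤ → LTree → LTree → LTree

label : LTree → ℤ
label (leaf z)     = z
label (node z _ _) = z

degree : LTree → ℕ
degree (leaf _)     = 1
degree (node _ l r) = degree l ℕ.+ degree r

-- f_V(v) = f_E(vL) + f_E(vR) - f_E(v-) + 1 for the internal vertex v
-- with parent edge label a and child subtrees l, r
fV : ℤ → LTree → LTree → ℤ
fV a l r = label l + label r - a + 1ℤ

-- Edges of t: 'here' is the edge above the top vertex of t.
data Edge : LTree → Set where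
  here : ∀ {t} → Edge t
  goL  : ∀ {a l r} → Edge l → Edge (node a l r)
  goR  : ∀ {a l r} → Edge r → Edge (node a l r)

-- subtree below an edge (its lower endpoint and everything under it)
sub : ∀ {t} → Edge t → LTree
sub {t} here = t
sub (goL e)  = sub e
sub (goR e)  = sub e

fE : ∀ {t} → Edge t → ℤ
fE e = label (sub e)

graft : ∀ {t} (e : Edge t) → Edge (sub e) → Edge t
graft here    c = c
graft (goL e) c = goL (graft e c)
graft (goR e) c = goR (graft e c)

IsLeaf : LTree → Set
IsLeaf (leaf _)     = ⊤
IsLeaf (node _ _ _) = ⊥

ind : ℤ → ℕ
ind z = if z ≤ᵇ 0ℤ then 1 else 0

BottomV : ℤ → LTree → LTree → Set
BottomV a l r = ind a ℕ.< ind (label l) ℕ.+ ind (label r)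

Bottom : LTree → Set
Bottom (leaf _)     = ⊥
Bottom (node a l r) = BottomV a l r

FVNonneg : LTree → Set
FVNonneg (leaf _)     = ⊤
FVNonneg (node a l r) = 0ℤ ≤ fV a l r

PartitionTree : LTree → Set
PartitionTree t = (e : Edge t) → FVNonneg (sub e)

TopZero : LTree → Set
TopZero (leaf _)     = ⊤
TopZero (node a l r) = ¬ BottomV a l r → fV a l r ≡ 0ℤ

FVZero : LTree → Set
FVZero (leaf _)     = ⊤
FVZero (node a l r) = fV a l r ≡ 0ℤ

HTree : LTree → Set
HTree t = PartitionTree t
        × ((e : Edge t) → (fE e ≡ 0ℤ → IsLeaf (sub e)) × (IsLeaf (sub e) → fE e ≡ 0ℤ))
        × ((e : Edge t) → TopZero (sub e))

PreQTree : LTree → Set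
PreQTree t = PartitionTree t
           × ((e : Edge t) → IsLeaf (sub e) → fE e ≤ 0ℤ)
           × ((e : Edge t) → FVZero (sub e))

data RegStart : (t : LTree) → Edge t → Set where
  rs-R : ∀ {a l r} → BottomV a l r → label r ≤ 0ℤ →
         RegStart (node a l r) (goR here)
  rs-L : ∀ {a l r} → BottomV a l r → label r > 0ℤ → label l ≤ 0ℤ →
         RegStart (node a l r) (goL here)

data SpecStart : (t : LTree) → Edge t → Set where
  ss : ∀ {a l r} → BottomV a l r → a > 0ℤ → label l ≤ 0ℤ → label r ≤ 0ℤ →
       SpecStart (node a l r) (goL here)

data NextLocal : (t : LTree) → Edge t → Set where
  nx-L : ∀ {a l r} → label l ≤ 0ℤ → NextLocal (node a l r) (goL here)
  nx-R : ∀ {a l r} → label l > 0ℤ → label r ≤ 0ℤ → NextLocal (node a l r) (goR here)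

data Step {t : LTree} (e : Edge t) : Edge t → Set where
  step : ∀ {c} → NextLocal (sub e) c → Step e (graft e c)

-- Names of paths: the regular path of the vertex below edge e, the root
-- path, the special path of the vertex below edge e.
data PathId (t : LTree) : Set where
  regular : Edge t → PathId t
  root    : PathId t
  special : Edge t → PathId t

-- Starts π s : the path π exists and its first edge is s
data Starts {t : LTree} : PathId t → Edge t → Set where
  st-reg  : ∀ {e c} → RegStart (sub e) c → Starts (regular e) (graft e c)
  st-root : label t ≤ 0ℤ → Starts root here
  st-spec : ∀ {e c} → SpecStart (sub e) c → Starts (special e) (graft e c)

OnPath : ∀ {t} → PathId t → Edge t → Set
OnPath {t} π e = Σ (Edge t) λ s → Starts π s × Star Step s e

SpecCond : LTree → Set
SpecCond (leaf _)     = ⊥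
SpecCond (node a l r) = fV a l r ≡ 0ℤ × a ≡ 1ℤ × label l ≡ 0ℤ × label r ≡ 0ℤ

PathProperties : LTree → Set
PathProperties t =
    ((π π' : PathId t) (e : Edge t) → π ≢ π' → OnPath π e → OnPath π' e → ⊥)
  × ((e : Edge t) → fE e ≤ 0ℤ → Σ (PathId t) λ π → OnPath π e)
  -- (3) every leaf is the endpoint of a path (the edge at the leaf is on a path)
  × ((e : Edge t) → IsLeaf (sub e) → Σ (PathId t) λ π → OnPath π e)
  × ((e s : Edge t) → Starts (special e) s → SpecCond (sub e))

-- Every non-positive edge is entered in exactly one way: the root edge only by
-- the root path, and a non-positive child edge c of a vertex v either by the
-- continuation rule from a non-positive parent edge of v, or as the first edge
-- of the regular path of v, or as the first edge of the special path of v.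
-- This purely local trichotomy gives (2) by induction on depth, and, since all
-- edges on paths are non-positive, gives (1) by following two paths backwards
-- from a common edge.  Property (3) follows from (2) because leaf edges are
-- non-positive, and (4) is the equality case of f_V ≥ 0 at a special start.
module Submission where

open import Defs
open import Data.Sum using (_⊎_; inj₁; inj₂)
open import Data.Product using (Σ; _×_; _,_; proj₁; proj₂; map₂)
open import Data.Integer using (ℤ; +_; 0ℤ; 1ℤ; _≤_; _>_; _+_; _-_; _≤ᵇ_; +≤+; -≤+; +<+)
open import Data.Integer.Properties using (_≤?_; ≰⇒>; ≤⇒≯; ≤-reflexive)
import Data.Nat as ℕ
open import Data.Nat using (ℕ; suc; z≤n; s≤s)
import Data.Nat.Properties as ℕ
open import Data.Nat.Induction using (<-wellFounded)
open import Data.Bool using (true; false)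
open import Data.Empty using (⊥; ⊥-elim)
open import Function using (id; flip; _∘_)
open import Induction.WellFounded using (Acc; acc)
open import Relation.Nullary using (¬_; yes; no)
open import Relation.Binary.PropositionalEquality using (_≡_; _≢_; refl; sym; cong; subst; subst₂)
open import Relation.Binary.Construct.Closure.ReflexiveTransitive using (Star; ε; _◅_; _◅◅_; reverse)


module _ {A I : Set} {Step : A → A → Set} {Start : I → A → Set} where

  chains-disjoint :
    (∀ {π π' s} → Start π s → Start π' s → π ≡ π') →
    (∀ {p p' e} → Step p e → Step p' e → p ≡ p') →
    (∀ {π π' s p e} → Start π s → Star Step s p → Step p e → Start π' e → ⊥) →
    ∀ {π π' e} →
    (Σ A λ s → Start π s × Star Step s e) →
    (Σ A λ s → Start π' s × Star Step s e) → π ≡ π'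
  chains-disjoint start-unique source-unique no-entry (_ , S , R) (_ , S' , R') =
    backwards S (reverse id R) S' (reverse id R')
    where
    backwards : ∀ {π π' s s' e} →
      Start π s → Star (flip Step) e s → Start π' s' → Star (flip Step) e s' → π ≡ π'
    backwards S ε S' ε = start-unique S S'
    backwards S ε S' (st' ◅ B') = ⊥-elim (no-entry S' (reverse id B') st' S)
    backwards S (st ◅ B) S' ε = ⊥-elim (no-entry S (reverse id B) st S')
    backwards S (st ◅ B) S' (st' ◅ B') with source-unique st st'
    ... | refl = backwards S B S' B'


ind-nonpos : ∀ {z} → z ≤ 0ℤ → ind z ≡ 1
ind-nonpos (+≤+ z≤n) = refl
ind-nonpos -≤+       = refl

ind-pos : ∀ {z} → z > 0ℤ → ind z ≡ 0
ind-pos (+<+ (s≤s z≤n)) = refl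

ind≤1 : ∀ z → ind z ℕ.≤ 1
ind≤1 z with z ≤ᵇ 0ℤ
... | true  = ℕ.≤-refl
... | false = z≤n

nonpos-ind≮pos-ind+ind : ∀ {a x} y → a ≤ 0ℤ → x > 0ℤ → ¬ (ind a ℕ.< ind x ℕ.+ ind y)
nonpos-ind≮pos-ind+ind y ha hx b =
  ℕ.<⇒≱ (subst₂ (λ i j → i ℕ.< j ℕ.+ ind y) (ind-nonpos ha) (ind-pos hx) b) (ind≤1 y)

module _ {a : ℤ} {l r : LTree} where

  bottom-nonpos : a ≤ 0ℤ → label l ≤ 0ℤ → label r ≤ 0ℤ → BottomV a l r
  bottom-nonpos ha hl hr rewrite ind-nonpos ha | ind-nonpos hl | ind-nonpos hr = ℕ.≤-refl

  bottom-posˡ : a > 0ℤ → label l ≤ 0ℤ → BottomV a l r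
  bottom-posˡ ha hl rewrite ind-pos ha | ind-nonpos hl = s≤s z≤n

  bottom-posʳ : a > 0ℤ → label r ≤ 0ℤ → BottomV a l r
  bottom-posʳ ha hr rewrite ind-pos ha | ind-nonpos hr = ℕ.m≤n+m 1 (ind (label l))

  ¬bottom-nonpos-posˡ : a ≤ 0ℤ → label l > 0ℤ → ¬ BottomV a l r
  ¬bottom-nonpos-posˡ = nonpos-ind≮pos-ind+ind (label r)

  ¬bottom-nonpos-posʳ : a ≤ 0ℤ → label r > 0ℤ → ¬ BottomV a l r
  ¬bottom-nonpos-posʳ ha hr b =
    nonpos-ind≮pos-ind+ind (label l) ha hr
      (subst (ind a ℕ.<_) (ℕ.+-comm (ind (label l)) (ind (label r))) b)


data Child : (u : LTree) → Edge u → Set where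
  left  : ∀ {a l r} → Child (node a l r) (goL here)
  right : ∀ {a l r} → Child (node a l r) (goR here)

ChildEdge : LTree → Set
ChildEdge t = Σ (Edge t) λ p → Edge (sub p)

goL-injective : ∀ {a l r} {e e' : Edge l} → goL {a} {l} {r} e ≡ goL e' → e ≡ e'
goL-injective refl = refl

goR-injective : ∀ {a l r} {e e' : Edge r} → goR {a} {l} {r} e ≡ goR e' → e ≡ e'
goR-injective refl = refl

sub-graft : ∀ {t} (p : Edge t) (c : Edge (sub p)) → sub (graft p c) ≡ sub c
sub-graft here    c = refl
sub-graft (goL p) c = sub-graft p c
sub-graft (goR p) c = sub-graft p c

fE-graft : ∀ {t} (p : Edge t) (c : Edge (sub p)) → fE (graft p c) ≡ label (sub c)
fE-graft p c = cong label (sub-graft p c)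

graft-child≢here : ∀ {t} {p : Edge t} {c} → Child (sub p) c → graft p c ≢ here
graft-child≢here {p = here}  left  ()
graft-child≢here {p = here}  right ()
graft-child≢here {p = goL p} _     ()
graft-child≢here {p = goR p} _     ()

graft-child-injective : ∀ {t} {p q : Edge t} {c c'} → Child (sub p) c → Child (sub q) c' →
                        graft p c ≡ graft q c' → _≡_ {A = ChildEdge t} (p , c) (q , c')
graft-child-injective {p = here}  {here}  _ _ refl = refl
graft-child-injective {p = here}  {goL q} left  ch' eq = ⊥-elim (graft-child≢here ch' (sym (goL-injective eq)))
graft-child-injective {p = here}  {goR q} right ch' eq = ⊥-elim (graft-child≢here ch' (sym (goR-injective eq)))
graft-child-injective {p = goL p} {here}  ch  left  eq = ⊥-elim (graft-child≢here ch (goL-injective eq))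
graft-child-injective {p = goR p} {here}  ch  right eq = ⊥-elim (graft-child≢here ch (goR-injective eq))
graft-child-injective {p = goL p} {goL q} ch ch' eq with graft-child-injective ch ch' (goL-injective eq)
... | refl = refl
graft-child-injective {p = goR p} {goR q} ch ch' eq with graft-child-injective ch ch' (goR-injective eq)
... | refl = refl

depth : ∀ {t} → Edge t → ℕ
depth here    = 0
depth (goL e) = suc (depth e)
depth (goR e) = suc (depth e)

depth-graft-child : ∀ {t} {p : Edge t} {c} → Child (sub p) c → depth p ℕ.< depth (graft p c)
depth-graft-child {p = here}  left  = s≤s z≤n
depth-graft-child {p = here}  right = s≤s z≤n
depth-graft-child {p = goL p} ch    = s≤s (depth-graft-child ch)
depth-graft-child {p = goR p} ch    = s≤s (depth-graft-child ch)

data ParentView {t : LTree} : Edge t → Set where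
  root-edge  : ParentView here
  child-edge : (p : Edge t) {c : Edge (sub p)} → Child (sub p) c → ParentView (graft p c)

parent-view : ∀ {t} (e : Edge t) → ParentView e
parent-view here = root-edge
parent-view (goL e) with parent-view e
... | root-edge       = child-edge here left
... | child-edge p ch = child-edge (goL p) ch
parent-view (goR e) with parent-view e
... | root-edge       = child-edge here right
... | child-edge p ch = child-edge (goR p) ch


data Entry (u : LTree) (c : Edge u) : Set where
  continued  : label u ≤ 0ℤ → NextLocal u c → Entry u c
  reg-start  : RegStart u c → Entry u c
  spec-start : SpecStart u c → Entry u c

child-entry : ∀ {u c} → Child u c → label (sub c) ≤ 0ℤ → Entry u c
child-entry (left {a} {l} {r}) hl with a ≤? 0ℤ | label r ≤? 0ℤ
... | yes ha | _      = continued ha (nx-L hl)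
... | no ha  | yes hr = spec-start (ss (bottom-posˡ {a} {l} {r} (≰⇒> ha) hl) (≰⇒> ha) hl hr)
... | no ha  | no hr  = reg-start (rs-L (bottom-posˡ {a} {l} {r} (≰⇒> ha) hl) (≰⇒> hr) hl)
child-entry (right {a} {l} {r}) hr with a ≤? 0ℤ | label l ≤? 0ℤ
... | no ha  | _      = reg-start (rs-R (bottom-posʳ {a} {l} {r} (≰⇒> ha) hr) hr)
... | yes ha | yes hl = reg-start (rs-R (bottom-nonpos {a} {l} {r} ha hl hr) hr)
... | yes ha | no hl  = continued ha (nx-R (≰⇒> hl) hr)

reg-start-not-continued : ∀ {u c} → RegStart u c → NextLocal u c → ¬ label u ≤ 0ℤ
reg-start-not-continued (rs-R {a} {l} {r} b _) (nx-R hl _) ha =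
  ¬bottom-nonpos-posˡ {a} {l} {r} ha hl b
reg-start-not-continued (rs-L {a} {l} {r} b hr _) (nx-L _) ha =
  ¬bottom-nonpos-posʳ {a} {l} {r} ha hr b

spec-start-not-continued : ∀ {u c} → SpecStart u c → NextLocal u c → ¬ label u ≤ 0ℤ
spec-start-not-continued (ss _ ha _ _) (nx-L _) ha' = ≤⇒≯ ha' ha

reg-start-not-spec-start : ∀ {u c} → RegStart u c → ¬ SpecStart u c
reg-start-not-spec-start (rs-L _ hr _) (ss _ _ _ hr') = ≤⇒≯ hr' hr

reg-start-child : ∀ {u c} → RegStart u c → Child u c
reg-start-child (rs-R _ _)   = right
reg-start-child (rs-L _ _ _) = left

spec-start-child : ∀ {u c} → SpecStart u c → Child u c
spec-start-child (ss _ _ _ _) = left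

next-child : ∀ {u c} → NextLocal u c → Child u c
next-child (nx-L _)   = left
next-child (nx-R _ _) = right

reg-start-nonpos : ∀ {u c} → RegStart u c → label (sub c) ≤ 0ℤ
reg-start-nonpos (rs-R _ hr)   = hr
reg-start-nonpos (rs-L _ _ hl) = hl

spec-start-nonpos : ∀ {u c} → SpecStart u c → label (sub c) ≤ 0ℤ
spec-start-nonpos (ss _ _ hl _) = hl

next-nonpos : ∀ {u c} → NextLocal u c → label (sub c) ≤ 0ℤ
next-nonpos (nx-L hl)   = hl
next-nonpos (nx-R _ hr) = hr


module _ {t : LTree} where

  graft-nonpos : (p : Edge t) (c : Edge (sub p)) → label (sub c) ≤ 0ℤ → fE (graft p c) ≤ 0ℤ
  graft-nonpos p c = subst (_≤ 0ℤ) (sym (fE-graft p c))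

  start-nonpos : ∀ {π : PathId t} {s} → Starts π s → fE s ≤ 0ℤ
  start-nonpos (st-reg {e} {c} rs)  = graft-nonpos e c (reg-start-nonpos rs)
  start-nonpos (st-root h)          = h
  start-nonpos (st-spec {e} {c} sp) = graft-nonpos e c (spec-start-nonpos sp)

  step-nonpos : ∀ {p e : Edge t} → Step p e → fE e ≤ 0ℤ
  step-nonpos {p} (step {c} nl) = graft-nonpos p c (next-nonpos nl)

  chain-nonpos : ∀ {s e : Edge t} → fE s ≤ 0ℤ → Star Step s e → fE e ≤ 0ℤ
  chain-nonpos h ε        = h
  chain-nonpos _ (st ◅ R) = chain-nonpos (step-nonpos st) R

  step-source-unique : ∀ {p p' e : Edge t} → Step p e → Step p' e → p ≡ p'
  step-source-unique {p} {p'} (step {c} nl) st' = go st' refl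
    where
    go : ∀ {e} → Step p' e → graft p c ≡ e → p ≡ p'
    go (step nl') eq = cong proj₁ (graft-child-injective (next-child nl) (next-child nl') eq)

  starts-unique : ∀ {π π' : PathId t} {s} → Starts π s → Starts π' s → π ≡ π'
  starts-unique (st-root _) S' = go S' refl
    where
    go : ∀ {π s} → Starts π s → s ≡ here → root ≡ π
    go (st-root _)  _  = refl
    go (st-reg rs)  eq = ⊥-elim (graft-child≢here (reg-start-child rs) eq)
    go (st-spec sp) eq = ⊥-elim (graft-child≢here (spec-start-child sp) eq)
  starts-unique (st-reg {e} {c} rs) S' = go S' refl
    where
    go : ∀ {π s} → Starts π s → graft e c ≡ s → regular e ≡ π
    go (st-root _)   eq = ⊥-elim (graft-child≢here (reg-start-child rs) eq)
    go (st-reg rs')  eq =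
      cong (regular ∘ proj₁) (graft-child-injective (reg-start-child rs) (reg-start-child rs') eq)
    go (st-spec sp)  eq with graft-child-injective (reg-start-child rs) (spec-start-child sp) eq
    ... | refl = ⊥-elim (reg-start-not-spec-start rs sp)
  starts-unique (st-spec {e} {c} sp) S' = go S' refl
    where
    go : ∀ {π s} → Starts π s → graft e c ≡ s → special e ≡ π
    go (st-root _)   eq = ⊥-elim (graft-child≢here (spec-start-child sp) eq)
    go (st-reg rs)   eq with graft-child-injective (spec-start-child sp) (reg-start-child rs) eq
    ... | refl = ⊥-elim (reg-start-not-spec-start rs sp)
    go (st-spec sp') eq =
      cong (special ∘ proj₁) (graft-child-injective (spec-start-child sp) (spec-start-child sp') eq)

  no-step-into-start : ∀ {π : PathId t} {p e} → Step p e → fE p ≤ 0ℤ → ¬ Starts π e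
  no-step-into-start {p = p} (step {c} nl) hp S = go S refl
    where
    go : ∀ {π s} → Starts π s → graft p c ≡ s → ⊥
    go (st-root _)  eq = graft-child≢here (next-child nl) eq
    go (st-reg rs)  eq with graft-child-injective (next-child nl) (reg-start-child rs) eq
    ... | refl = reg-start-not-continued rs nl hp
    go (st-spec sp) eq with graft-child-injective (next-child nl) (spec-start-child sp) eq
    ... | refl = spec-start-not-continued sp nl hp

  paths-disjoint : (π π' : PathId t) (e : Edge t) → π ≢ π' → OnPath π e → OnPath π' e → ⊥
  paths-disjoint _ _ _ π≢π' on on' = π≢π' (chains-disjoint starts-unique step-source-unique
    (λ S R st S' → no-step-into-start st (chain-nonpos (start-nonpos S) R) S') on on')

  extend-path : ∀ {π : PathId t} {p e} → OnPath π p → Step p e → OnPath π e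
  extend-path (s , S , R) st = s , S , R ◅◅ st ◅ ε

  nonpos-on-path′ : (e : Edge t) → Acc ℕ._<_ (depth e) → fE e ≤ 0ℤ →
                    Σ (PathId t) λ π → OnPath π e
  nonpos-on-path′ e (acc below) h with parent-view e
  ... | root-edge = root , here , st-root h , ε
  ... | child-edge p {c} ch with child-entry ch (subst (_≤ 0ℤ) (fE-graft p c) h)
  ...   | continued hp nl =
          map₂ (λ on → extend-path on (step nl)) (nonpos-on-path′ p (below (depth-graft-child ch)) hp)
  ...   | reg-start rs  = regular p , graft p c , st-reg rs , ε
  ...   | spec-start sp = special p , graft p c , st-spec sp , ε

  nonpos-on-path : (e : Edge t) → fE e ≤ 0ℤ → Σ (PathId t) λ π → OnPath π e
  nonpos-on-path e = nonpos-on-path′ e (<-wellFounded (depth e))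


b+c-a+1≥0⇒tight : ∀ {a b c} → 0ℤ ≤ b + c - a + 1ℤ → a > 0ℤ → b ≤ 0ℤ → c ≤ 0ℤ →
                  (b + c - a + 1ℤ ≡ 0ℤ) × (a ≡ 1ℤ) × (b ≡ 0ℤ) × (c ≡ 0ℤ)
b+c-a+1≥0⇒tight {+ 1}           _  (+<+ _) (+≤+ z≤n) (+≤+ z≤n) = refl , refl , refl , refl
b+c-a+1≥0⇒tight {+ suc (suc _)} () (+<+ _) (+≤+ z≤n) (+≤+ z≤n)
b+c-a+1≥0⇒tight {+ suc _}       () (+<+ _) (+≤+ z≤n) -≤+
b+c-a+1≥0⇒tight {+ suc _}       () (+<+ _) -≤+       (+≤+ z≤n)
b+c-a+1≥0⇒tight {+ suc _}       () (+<+ _) -≤+       -≤+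

special-start-condition : ∀ {u c} → SpecStart u c → FVNonneg u → SpecCond u
special-start-condition (ss _ ha hl hr) fV≥0 = b+c-a+1≥0⇒tight fV≥0 ha hl hr


partition-tree : ∀ {t} → HTree t ⊎ PreQTree t → PartitionTree t
partition-tree (inj₁ (pt , _)) = pt
partition-tree (inj₂ (pt , _)) = pt

leaf-edge-nonpos : ∀ {t} → HTree t ⊎ PreQTree t → (e : Edge t) → IsLeaf (sub e) → fE e ≤ 0ℤ
leaf-edge-nonpos (inj₁ (_ , zero-iff-leaf , _)) e lf = ≤-reflexive (proj₂ (zero-iff-leaf e) lf)
leaf-edge-nonpos (inj₂ (_ , leaf-nonpos , _))   e lf = leaf-nonpos e lf

lemma4p3 : (t : LTree) → HTree t ⊎ PreQTree t → PathProperties t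
lemma4p3 t tree = paths-disjoint , nonpos-on-path , leaf-on-path , special-path-start
  where
  leaf-on-path : (e : Edge t) → IsLeaf (sub e) → Σ (PathId t) λ π → OnPath π e
  leaf-on-path e lf = nonpos-on-path e (leaf-edge-nonpos tree e lf)

  special-path-start : (e s : Edge t) → Starts (special e) s → SpecCond (sub e)
  special-path-start e _ (st-spec sp) = special-start-condition sp (partition-tree tree e)
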